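{- Let $q$ be a positive integer. Every $q$-necklace has tree-width at most $\max\{q-1,2\}$.
   Context: For an integer $q>0$, a $q$-necklace with chain $v_1v_2\cdots v_n$ is a multigraph $G$ with $V(G)=\{v_1,\ldots,v_n\}$ such that: (1) $v_1v_2\cdots v_nv_1$ is a cycle $C$ of $G$; (2) $G$ contains pairwise edge-disjoint complete subgraphs $M_1,\ldots,M_k$, each having at most $q$ vertices, such that $E(G)-E(C)=\bigcup_{i=1}^k E(M_i)$; (3) there exist no integers $i,j,a,b,c,d$ with $i\ne j$ and $a<b<c<d$ such that $\{v_a,v_c\}\subseteq V(M_i)$ and $\{v_b,v_d\}\subseteq V(M_j)$. A tree-decomposition of a graph $G$ is a pair $(T,\{X_t\}_{t\in V(T)})$ with $T$ a tree and $X_t\subseteq V(G)$ such that $\bigcup_t X_t=V(G)$, every edge has both ends in some $X_t$, and for each vertex $v$ the set $\{t: v\in X_t\}$ induces a connected subtree of $T$; its width is $\max_t |X_t|-1$, and the tree-width is the minimum width of a tree-decomposition. -}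

module Defs where

open import Data.Nat using (ℕ; zero; suc; _+_; _≤_)
open import Data.Fin using (Fin; zero; suc) renaming (_<_ to _<ᶠ_)
open import Data.Fin.Subset using (Subset; _∈_; ∣_∣)
open import Data.Product using (Σ; ∃; ∃-syntax; _×_; _,_; proj₁; proj₂)
open import Data.Sum using (_⊎_)
open import Data.Unit using (⊤)
open import Data.Empty using (⊥)
open import Relation.Nullary using (¬_)
open import Relation.Binary.PropositionalEquality using (_≡_; _≢_)
open import Function.Definitions using (Injective)
open import Function.Bundles using (_⇔_)

-- Cyclic successor on Fin (suc n): i ↦ i+1 (mod n+1)

next : ∀ {n} → Fin (suc n) → Fin (suc n)
next {zero}  zero    = zero
next {suc n} zero    = suc zero
next {suc n} (suc i) with next {n} i
... | zero  = zero
... | suc j = suc (suc j)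

-- Finite multigraphs: vertices Fin n, edges Fin m, each edge has two
-- ends (unordered; the order of the pair is irrelevant, see Joins).

record Multigraph (n : ℕ) : Set where
  field
    m    : ℕ
    ends : Fin m → Fin n × Fin n

open Multigraph public

Joins : ∀ {n} (G : Multigraph n) → Fin (m G) → Fin n → Fin n → Set
Joins G e u v = (ends G e ≡ (u , v)) ⊎ (ends G e ≡ (v , u))

record Clique (q : ℕ) {n} (G : Multigraph n) : Set₁ where
  field
    VS       : Subset n
    ES       : Fin (m G) → Set
    small    : ∣ VS ∣ ≤ q
    es-ok    : ∀ e → ES e →
                 ∃[ u ] ∃[ v ] (u ≢ v × u ∈ VS × v ∈ VS × Joins G e u v)
    complete : ∀ u v → u ∈ VS → v ∈ VS → u ≢ v →
                 ∃[ e ] ((ES e × Joins G e u v) ×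
                         (∀ e′ → ES e′ → Joins G e′ u v → e′ ≡ e))

open Clique public

-- q-necklace with chain v₁ v₂ ⋯ vₙ, where the vertex vᵢ is the i-th
-- element of Fin (suc n) (so the chain order is the order of Fin).

record IsNecklace (q : ℕ) {n} (G : Multigraph (suc n)) : Set₁ where
  field
    cyc        : Fin (suc n) → Fin (m G)
    cyc-inj    : Injective _≡_ _≡_ cyc
    cyc-joins  : ∀ i → Joins G (cyc i) i (next i)
    k          : ℕ
    M          : Fin k → Clique q G
    disjoint   : ∀ i j → i ≢ j → ∀ e → ¬ (ES (M i) e × ES (M j) e)
    cover      : ∀ e → (¬ (∃[ i ] cyc i ≡ e)) ⇔ (∃[ i ] ES (M i) e)
    noncross   : ∀ (i j : Fin k) (a b c d : Fin (suc n)) → i ≢ j →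
                   a <ᶠ b → b <ᶠ c → c <ᶠ d →
                   a ∈ VS (M i) → c ∈ VS (M i) →
                   b ∈ VS (M j) → d ∈ VS (M j) → ⊥

data WalkIn {t : ℕ} (A : Fin t → Fin t → Set) (P : Fin t → Set)
            : Fin t → Fin t → Set where
  here : ∀ {x} → P x → WalkIn A P x x
  step : ∀ {x y z} → P x → A x y → WalkIn A P y z → WalkIn A P x z

record Tree : Set₁ where
  field
    size-1    : ℕ
    Adj       : Fin (suc size-1) → Fin (suc size-1) → Set
    adj-sym   : ∀ {x y} → Adj x y → Adj y x
    adj-irr   : ∀ {x} → ¬ Adj x x
    connected : ∀ x y → WalkIn Adj (λ _ → ⊤) x y
    acyclic   : ∀ (l : ℕ) (f : Fin (suc (suc (suc l))) → Fin (suc size-1)) →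
                  Injective _≡_ _≡_ f → ¬ (∀ i → Adj (f i) (f (next i)))

open Tree public

Node : Tree → Set
Node T = Fin (suc (size-1 T))

record TreeDecomposition {n} (G : Multigraph n) : Set₁ where
  field
    T        : Tree
    X        : Node T → Subset n
    covers   : ∀ v → ∃[ t ] v ∈ X t
    edges    : ∀ e → ∃[ t ] (proj₁ (ends G e) ∈ X t × proj₂ (ends G e) ∈ X t)
    subtree  : ∀ v (a b : Node T) → v ∈ X a → v ∈ X b →
                 WalkIn (Adj T) (λ s → v ∈ X s) a b

open TreeDecomposition public

-- width = max_t |X_t| − 1 ≤ w  ⇔  every bag has at most w + 1 vertices
HasWidth≤ : ∀ {n} {G : Multigraph n} → TreeDecomposition G → ℕ → Set
HasWidth≤ D w = ∀ t → ∣ X D t ∣ ≤ w + 1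

TreeWidth≤ : ∀ {n} → Multigraph n → ℕ → Set₁
TreeWidth≤ G w = Σ (TreeDecomposition G) (λ D → HasWidth≤ D w)

module Submission where

-- Number the chain by 0 … n.  A block is a clique Mⱼ or a
-- cycle edge {i, i+1}; distinct blocks do not cross, and the ends of every
-- edge lie in a common block.  Starting from (0, n), whose ends share the
-- cycle edge n0, split an interval (a, b) whose ends share a block at
-- c = split a b, the last vertex of (a, b) sharing a block with a, and
-- recurse on (a, c) and (c, b).  Each interior vertex c splits exactly one
-- interval; it becomes a tree node with bag {a, b, c} ∪ {x ∈ (a, b) | a
-- block contains a, b, x} and with the split point of the enclosing
-- interval as parent.  Node 0 (bag {0, n}) is the root and node n (bag {n})
-- its child.  Non-crossing shows: every bag lies in a clique or has at most
-- three vertices; every block pair lies in a bag; among the nodes whose bag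
-- contains a vertex x, exactly one is topmost, so they form a subtree.

open import Defs
open import Data.Nat using (ℕ; zero; suc; _+_; _≤_; _<_; z≤n; s≤s; pred; _≤?_; _<?_; _∸_; _⊔_)
open import Data.Nat.Properties
open import Data.Nat.Induction using (<-wellFounded)
open import Induction.WellFounded using (Acc; acc)
open import Data.Fin using (Fin; zero; suc; toℕ; fromℕ<; fromℕ; inject₁)
open import Data.Fin.Properties using (toℕ-injective; toℕ-fromℕ<; toℕ<n; toℕ-fromℕ; toℕ-inject₁; any?)
  renaming (_≟_ to _≟ᶠ_)
open import Data.Fin.Subset using (Subset; _∈_; ∣_∣; _∪_; ⁅_⁆; inside; outside; _⊆_)
open import Data.Fin.Subset.Properties using (_∈?_; x∈⁅x⁆; x∈p∪q⁺; p⊆q⇒∣p∣≤∣q∣; ∣⁅x⁆∣≡1)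
open import Data.Vec using ([]; _∷_; tabulate)
open import Data.Vec.Properties using (lookup∘tabulate; []=⇒lookup; lookup⇒[]=)
open import Data.Bool.Properties using (T-≡)
open import Data.Product using (∃; ∃-syntax; _×_; _,_; proj₁; proj₂; uncurry)
open import Data.Sum using (_⊎_; inj₁; inj₂; [_,_]; map₂)
import Data.Sum.Properties as Sum
open import Data.Unit using (⊤; tt)
open import Data.Empty using (⊥; ⊥-elim)
open import Relation.Nullary using (¬_; Dec; yes; no; does)
open import Relation.Nullary.Decidable using (_×-dec_; _⊎-dec_; dec-true; toWitness; isYes≗does)
open import Relation.Binary using (Tri; tri<; tri≈; tri>)
open import Relation.Binary.PropositionalEquality hiding ([_])
open import Function.Bundles using (Equivalence)
open import Function.Definitions using (Injective)
open import Function.Base using (_∘′_)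

_++ʷ_ : ∀ {t} {A : Fin t → Fin t → Set} {P : Fin t → Set} {x y z} →
        WalkIn A P x y → WalkIn A P y z → WalkIn A P x z
here _       ++ʷ w′ = w′
step px a w  ++ʷ w′ = step px a (w ++ʷ w′)

snocʷ : ∀ {t} {A : Fin t → Fin t → Set} {P : Fin t → Set} {x y z} →
        WalkIn A P x y → A y z → P z → WalkIn A P x z
snocʷ (here px)     a′ pz = step px a′ (here pz)
snocʷ (step px a w) a′ pz = step px a (snocʷ w a′ pz)

reverseʷ : ∀ {t} {A : Fin t → Fin t → Set} {P : Fin t → Set} →
           (∀ {x y} → A x y → A y x) → ∀ {x y} → WalkIn A P x y → WalkIn A P y x
reverseʷ sym-A (here px)     = here px
reverseʷ sym-A (step px a w) = snocʷ (reverseʷ sym-A w) (sym-A a) px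

toℕ-next : ∀ {m} (i : Fin (suc m)) →
           (toℕ (next i) ≡ suc (toℕ i)) ⊎ (toℕ i ≡ m × toℕ (next i) ≡ 0)
toℕ-next {zero}  zero    = inj₂ (refl , refl)
toℕ-next {suc m} zero    = inj₁ refl
toℕ-next {suc m} (suc i) with next {m} i | toℕ-next {m} i
... | zero  | inj₁ ()
... | zero  | inj₂ (i≡m , _) = inj₂ (cong suc i≡m , refl)
... | suc j | inj₁ eq        = inj₁ (cong suc eq)
... | suc j | inj₂ (_ , ())

next-surjective : ∀ {m} (i : Fin (suc m)) → ∃[ j ] next j ≡ i
next-surjective {m} zero with toℕ-next (fromℕ m)
... | inj₁ eq = ⊥-elim (<-irrefl refl (subst (_< suc m)
                  (trans eq (cong suc (toℕ-fromℕ m))) (toℕ<n (next (fromℕ m)))))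
... | inj₂ (_ , eq) = fromℕ m , toℕ-injective eq
next-surjective {m} (suc i) with toℕ-next (inject₁ i)
... | inj₁ eq = inject₁ i , toℕ-injective (trans eq (cong suc (toℕ-inject₁ i)))
... | inj₂ (eq , _) = ⊥-elim (<-irrefl (trans (sym (toℕ-inject₁ i)) eq) (toℕ<n i))

next∘next≢id : ∀ {l} (i : Fin (suc (suc (suc l)))) → next (next i) ≢ i
next∘next≢id {l} i eq with toℕ-next i | toℕ-next (next i)
... | inj₁ a | inj₁ b = <-irrefl (sym (trans (sym (trans b (cong suc a))) (cong toℕ eq)))
                                 (n≤1+n (suc (toℕ i)))
... | inj₁ a | inj₂ (b , b′) with trans (sym (trans (sym (cong toℕ eq)) b′)) (suc-injective (trans (sym a) b))
...   | ()
next∘next≢id {l} i eq | inj₂ (a , a′) | inj₁ b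
  with trans (sym (trans b (cong suc a′))) (trans (cong toℕ eq) a)
... | ()
next∘next≢id {l} i eq | inj₂ (a , a′) | inj₂ (b , b′) with trans (sym a′) b
... | ()

argmax : ∀ {m} (g : Fin (suc m) → ℕ) → ∃[ i ] (∀ j → g j ≤ g i)
argmax {zero} g = zero , λ { zero → ≤-refl }
argmax {suc m} g with argmax {m} (λ j → g (suc j))
... | i , max with g zero ≤? g (suc i)
...   | yes le = suc i , λ { zero → le ; (suc j) → max j }
...   | no nle = zero  , λ { zero → ≤-refl ; (suc j) → ≤-trans (max j) (<⇒≤ (≰⇒> nle)) }

-- Climbing to the root shows connectivity; on a cycle, the node of
-- largest rank would be the parent of both of its cycle neighbours, so its
-- successor on the cycle would be its predecessor, impossible for length ≥ 3.

module ParentTree (n : ℕ) (parent rank : ℕ → ℕ)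
  (parent-ok : ∀ v → v ≤ n → v ≢ 0 → parent v ≤ n × rank (parent v) < rank v) where

  Nd : Set
  Nd = Fin (suc n)

  Edge : Nd → Nd → Set
  Edge x y = (toℕ x ≢ 0 × parent (toℕ x) ≡ toℕ y) ⊎ (toℕ y ≢ 0 × parent (toℕ y) ≡ toℕ x)

  edge-sym : ∀ {x y} → Edge x y → Edge y x
  edge-sym (inj₁ h) = inj₂ h
  edge-sym (inj₂ h) = inj₁ h

  toℕ≤n : (x : Nd) → toℕ x ≤ n
  toℕ≤n x = ≤-pred (toℕ<n x)

  parent-rank : ∀ x → toℕ x ≢ 0 → rank (parent (toℕ x)) < rank (toℕ x)
  parent-rank x x≢0 = proj₂ (parent-ok (toℕ x) (toℕ≤n x) x≢0)

  edge-irrefl : ∀ {x} → ¬ Edge x x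
  edge-irrefl {x} (inj₁ (x≢0 , e)) = <-irrefl (cong rank e) (parent-rank x x≢0)
  edge-irrefl {x} (inj₂ (x≢0 , e)) = <-irrefl (cong rank e) (parent-rank x x≢0)

  up : (x : Nd) → toℕ x ≢ 0 → Nd
  up x x≢0 = fromℕ< (s≤s (proj₁ (parent-ok (toℕ x) (toℕ≤n x) x≢0)))

  toℕ-up : ∀ x x≢0 → toℕ (up x x≢0) ≡ parent (toℕ x)
  toℕ-up x x≢0 = toℕ-fromℕ< _

  edge-up : ∀ x x≢0 → Edge x (up x x≢0)
  edge-up x x≢0 = inj₁ (x≢0 , sym (toℕ-up x x≢0))

  -- From every node of Q one reaches
  -- a Q-topmost node within Q; so if the Q-topmost node is unique, Q is
  -- connected in the tree.
  module Climb (Q : Nd → Set) (Q? : ∀ x → Dec (Q x)) where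

    Topmost : Nd → Set
    Topmost t = toℕ t ≡ 0 ⊎ ((t≢0 : toℕ t ≢ 0) → ¬ Q (up t t≢0))

    climb : ∀ x → Acc _<_ (rank (toℕ x)) → Q x → ∃[ t ] (WalkIn Edge Q x t × Topmost t × Q t)
    climb x (acc rs) qx with toℕ x ≟ 0
    ... | yes x≡0 = x , here qx , inj₁ x≡0 , qx
    ... | no x≢0 with Q? (up x x≢0)
    ...   | no ¬q = x , here qx , inj₂ (λ x≢0′ q → ¬q (subst Q (up-irrelevant x≢0′) q)) , qx
      where
        up-irrelevant : ∀ x≢0′ → up x x≢0′ ≡ up x x≢0
        up-irrelevant x≢0′ = toℕ-injective (trans (toℕ-up x x≢0′) (sym (toℕ-up x x≢0)))
    ...   | yes q with climb (up x x≢0) (rs (subst (λ z → rank z < rank (toℕ x))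
                                               (sym (toℕ-up x x≢0)) (parent-rank x x≢0))) q
    ...     | t , w , top , qt = t , step qx (edge-up x x≢0) w , top , qt

    connect-within : (∀ t₁ t₂ → Q t₁ → Q t₂ → Topmost t₁ → Topmost t₂ → t₁ ≡ t₂) →
                     ∀ a b → Q a → Q b → WalkIn Edge Q a b
    connect-within unique a b qa qb
      with climb a (<-wellFounded _) qa | climb b (<-wellFounded _) qb
    ... | t₁ , w₁ , top₁ , q₁ | t₂ , w₂ , top₂ , q₂ rewrite unique t₁ t₂ q₁ q₂ top₁ top₂ =
      w₁ ++ʷ reverseʷ edge-sym w₂

  open Climb public

  -- With Q everything, the only topmost node is the root.
  edge-connected : ∀ x y → WalkIn Edge (λ _ → ⊤) x y
  edge-connected x y = connect-within (λ _ → ⊤) (λ _ → yes tt) unique x y tt tt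
    where
      is-root : ∀ t → Topmost (λ _ → ⊤) (λ _ → yes tt) t → t ≡ zero
      is-root t (inj₁ t≡0) = toℕ-injective t≡0
      is-root t (inj₂ no-parent) with toℕ t ≟ 0
      ... | yes t≡0 = toℕ-injective t≡0
      ... | no t≢0  = ⊥-elim (no-parent t≢0 tt)
      unique : ∀ t₁ t₂ → ⊤ → ⊤ → Topmost (λ _ → ⊤) (λ _ → yes tt) t₁ →
               Topmost (λ _ → ⊤) (λ _ → yes tt) t₂ → t₁ ≡ t₂
      unique t₁ t₂ _ _ top₁ top₂ = trans (is-root t₁ top₁) (sym (is-root t₂ top₂))

  edge-acyclic : ∀ (l : ℕ) (f : Fin (suc (suc (suc l))) → Nd) →
             Injective _≡_ _≡_ f → ¬ (∀ i → Edge (f i) (f (next i)))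
  edge-acyclic l f f-inj cycle with argmax (λ i → rank (toℕ (f i)))
  ... | i , max with next-surjective i
  ... | j , next-j≡i = both-children (cycle i) (subst (λ z → Edge (f j) (f z)) next-j≡i (cycle j))
    where
      -- a child of f i would have rank above the maximum
      not-parent-of : ∀ u → toℕ (f u) ≢ 0 → parent (toℕ (f u)) ≢ toℕ (f i)
      not-parent-of u fu≢0 e = <-irrefl refl
        (≤-trans (subst (λ z → suc (rank z) ≤ rank (toℕ (f u))) e (parent-rank (f u) fu≢0)) (max u))
      both-children : Edge (f i) (f (next i)) → Edge (f j) (f i) → ⊥
      both-children _ (inj₁ (fj≢0 , e)) = not-parent-of j fj≢0 e
      both-children (inj₂ (fn≢0 , e)) _ = not-parent-of (next i) fn≢0 e
      both-children (inj₁ (_ , e₁)) (inj₂ (_ , e₂)) =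
        next∘next≢id i (trans (cong next (sym (f-inj (toℕ-injective (trans (sym e₂) e₁))))) next-j≡i)

  tree : Tree
  tree = record
    { size-1 = n ; Adj = Edge ; adj-sym = edge-sym ; adj-irr = edge-irrefl
    ; connected = edge-connected ; acyclic = edge-acyclic }

subsetOf : ∀ {m} {P : Fin m → Set} → (∀ i → Dec (P i)) → Subset m
subsetOf P? = tabulate (λ i → does (P? i))

∈-subsetOf⁻ : ∀ {m} {P : Fin m → Set} (P? : ∀ i → Dec (P i)) {i} → i ∈ subsetOf P? → P i
∈-subsetOf⁻ P? {i} i∈ = toWitness {a? = P? i} (Equivalence.from T-≡
  (trans (isYes≗does (P? i)) (trans (sym (lookup∘tabulate (λ j → does (P? j)) i)) ([]=⇒lookup i∈))))

∈-subsetOf⁺ : ∀ {m} {P : Fin m → Set} (P? : ∀ i → Dec (P i)) {i} → P i → i ∈ subsetOf P?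
∈-subsetOf⁺ P? {i} p = lookup⇒[]= i (subsetOf P?)
  (trans (lookup∘tabulate (λ j → does (P? j)) i) (dec-true (P? i) p))

∣p∪q∣≤∣p∣+∣q∣ : ∀ {m} (p r : Subset m) → ∣ p ∪ r ∣ ≤ ∣ p ∣ + ∣ r ∣
∣p∪q∣≤∣p∣+∣q∣ []           []           = z≤n
∣p∪q∣≤∣p∣+∣q∣ (inside ∷ p)  (inside ∷ r)  =
  s≤s (≤-trans (∣p∪q∣≤∣p∣+∣q∣ p r) (≤-trans (n≤1+n _) (≤-reflexive (sym (+-suc _ _)))))
∣p∪q∣≤∣p∣+∣q∣ (inside ∷ p)  (outside ∷ r) = s≤s (∣p∪q∣≤∣p∣+∣q∣ p r)
∣p∪q∣≤∣p∣+∣q∣ (outside ∷ p) (inside ∷ r)  =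
  ≤-trans (s≤s (∣p∪q∣≤∣p∣+∣q∣ p r)) (≤-reflexive (sym (+-suc _ _)))
∣p∪q∣≤∣p∣+∣q∣ (outside ∷ p) (outside ∷ r) = ∣p∪q∣≤∣p∣+∣q∣ p r

∣⊆three∣≤3 : ∀ {m} (X : Subset m) (a b c : Fin m) →
             (∀ i → i ∈ X → i ≡ a ⊎ i ≡ b ⊎ i ≡ c) → ∣ X ∣ ≤ 3
∣⊆three∣≤3 X a b c among = begin
  ∣ X ∣                                       ≤⟨ p⊆q⇒∣p∣≤∣q∣ X⊆abc ⟩
  ∣ ⁅ a ⁆ ∪ (⁅ b ⁆ ∪ ⁅ c ⁆) ∣                 ≤⟨ ∣p∪q∣≤∣p∣+∣q∣ ⁅ a ⁆ _ ⟩
  ∣ ⁅ a ⁆ ∣ + ∣ ⁅ b ⁆ ∪ ⁅ c ⁆ ∣               ≤⟨ +-monoʳ-≤ ∣ ⁅ a ⁆ ∣ (∣p∪q∣≤∣p∣+∣q∣ ⁅ b ⁆ ⁅ c ⁆) ⟩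
  ∣ ⁅ a ⁆ ∣ + (∣ ⁅ b ⁆ ∣ + ∣ ⁅ c ⁆ ∣)         ≡⟨ cong₂ _+_ (∣⁅x⁆∣≡1 a) (cong₂ _+_ (∣⁅x⁆∣≡1 b) (∣⁅x⁆∣≡1 c)) ⟩
  3                                           ∎
  where
    open ≤-Reasoning
    X⊆abc : X ⊆ (⁅ a ⁆ ∪ (⁅ b ⁆ ∪ ⁅ c ⁆))
    X⊆abc {i} i∈X with among i i∈X
    ... | inj₁ refl        = x∈p∪q⁺ (inj₁ (x∈⁅x⁆ i))
    ... | inj₂ (inj₁ refl) = x∈p∪q⁺ (inj₂ (x∈p∪q⁺ (inj₁ (x∈⁅x⁆ i))))
    ... | inj₂ (inj₂ refl) = x∈p∪q⁺ (inj₂ (x∈p∪q⁺ (inj₂ (x∈⁅x⁆ i))))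

-- Three strictly increasing numbers are not all among two values (so a
-- cycle edge does not contain three vertices).

no-three-among-two : ∀ {u w a x b : ℕ} → (a ≡ u ⊎ a ≡ w) → (x ≡ u ⊎ x ≡ w) → (b ≡ u ⊎ b ≡ w) →
                     a < x → x < b → ⊥
no-three-among-two (inj₁ refl) (inj₁ refl) _           a<x _   = <-irrefl refl a<x
no-three-among-two (inj₂ refl) (inj₂ refl) _           a<x _   = <-irrefl refl a<x
no-three-among-two _           (inj₁ refl) (inj₁ refl) _   x<b = <-irrefl refl x<b
no-three-among-two _           (inj₂ refl) (inj₂ refl) _   x<b = <-irrefl refl x<b
no-three-among-two (inj₁ refl) (inj₂ refl) (inj₁ refl) a<x x<b = <-asym a<x x<b
no-three-among-two (inj₂ refl) (inj₁ refl) (inj₂ refl) a<x x<b = <-asym a<x x<b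

-- Everything below concerns one fixed q-necklace; vertices are handled as
-- natural numbers 0 … n, i.e. through toℕ.

module Necklace (q : ℕ) {n : ℕ} (G : Multigraph (suc n)) (NK : IsNecklace q G) where
  open IsNecklace NK

  toℕ≤n : (i : Fin (suc n)) → toℕ i ≤ n
  toℕ≤n i = ≤-pred (toℕ<n i)

  -- Blocks: the cliques Mⱼ and the cycle edges {i, next i}.
  Block : Set
  Block = Fin k ⊎ Fin (suc n)

  _≟ᴮ_ : (x y : Block) → Dec (x ≡ y)
  _≟ᴮ_ = Sum.≡-dec _≟ᶠ_ _≟ᶠ_

  InBlock : Block → ℕ → Set
  InBlock (inj₁ j) x = ∃[ i ] (toℕ i ≡ x × i ∈ VS (M j))
  InBlock (inj₂ i) x = x ≡ toℕ i ⊎ x ≡ toℕ (next i)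

  InBlock? : ∀ B x → Dec (InBlock B x)
  InBlock? (inj₁ j) x = any? (λ i → (toℕ i ≟ x) ×-dec (i ∈? VS (M j)))
  InBlock? (inj₂ i) x = (x ≟ toℕ i) ⊎-dec (x ≟ toℕ (next i))

  InBlock⇒≤n : ∀ B {x} → InBlock B x → x ≤ n
  InBlock⇒≤n (inj₁ j) (i , refl , _) = toℕ≤n i
  InBlock⇒≤n (inj₂ i) (inj₁ refl)    = toℕ≤n i
  InBlock⇒≤n (inj₂ i) (inj₂ refl)    = toℕ≤n (next i)

  any-block? : (P : Block → Set) → (∀ B → Dec (P B)) → Dec (∃ P)
  any-block? P P? with any? (λ j → P? (inj₁ j)) | any? (λ i → P? (inj₂ i))
  ... | yes (j , p) | _           = yes (inj₁ j , p)
  ... | no _        | yes (i , p) = yes (inj₂ i , p)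
  ... | no ¬clique  | no ¬edge    = no λ { (inj₁ j , p) → ¬clique (j , p) ; (inj₂ i , p) → ¬edge (i , p) }

  cycle-edge-ends : ∀ i {x y} → InBlock (inj₂ i) x → InBlock (inj₂ i) y → x < y →
                    y ≡ suc x ⊎ (x ≡ 0 × y ≡ n)
  cycle-edge-ends i hx hy x<y with toℕ-next i
  cycle-edge-ends i (inj₁ refl) (inj₁ refl) x<y | _ = ⊥-elim (<-irrefl refl x<y)
  cycle-edge-ends i (inj₂ refl) (inj₂ refl) x<y | _ = ⊥-elim (<-irrefl refl x<y)
  cycle-edge-ends i (inj₁ refl) (inj₂ refl) x<y | inj₁ e = inj₁ e
  cycle-edge-ends i (inj₁ refl) (inj₂ refl) x<y | inj₂ (_ , e) = ⊥-elim (n≮0 (subst (toℕ i <_) e x<y))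
  cycle-edge-ends i (inj₂ refl) (inj₁ refl) x<y | inj₁ e = ⊥-elim (<-asym x<y (subst (toℕ i <_) (sym e) ≤-refl))
  cycle-edge-ends i (inj₂ refl) (inj₁ refl) x<y | inj₂ (e₁ , e₂) = inj₂ (e₂ , e₁)

  -- Distinct blocks do not cross: condition (3) for two cliques, and a cycle
  -- edge has no vertex strictly between its ends (in one of the two arcs).
  blocks-noncrossing : ∀ B B′ {a b c d} → B ≢ B′ → a < b → b < c → c < d →
                       InBlock B a → InBlock B c → InBlock B′ b → InBlock B′ d → ⊥
  blocks-noncrossing (inj₂ i) B′ {a} {b} {c} {d} _ a<b b<c c<d ha hc hb hd
    with cycle-edge-ends i ha hc (<-trans a<b b<c)
  ... | inj₁ refl       = <⇒≱ a<b (≤-pred b<c)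
  ... | inj₂ (_ , refl) = <-irrefl refl (≤-trans c<d (InBlock⇒≤n B′ hd))
  blocks-noncrossing (inj₁ j) (inj₂ i) {a} {b} {c} {d} _ a<b b<c c<d ha hc hb hd
    with cycle-edge-ends i hb hd (<-trans b<c c<d)
  ... | inj₁ refl       = <⇒≱ b<c (≤-pred c<d)
  ... | inj₂ (refl , _) = n≮0 a<b
  blocks-noncrossing (inj₁ i) (inj₁ j) B≢B′ a<b b<c c<d
                     (va , refl , a∈) (vc , refl , c∈) (vb , refl , b∈) (vd , refl , d∈) =
    noncross i j va vb vc vd (λ i≡j → B≢B′ (cong inj₁ i≡j)) a<b b<c c<d a∈ c∈ b∈ d∈

  _~_ : ℕ → ℕ → Set
  x ~ y = ∃[ B ] (InBlock B x × InBlock B y)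

  _~?_ : ∀ x y → Dec (x ~ y)
  x ~? y = any-block? (λ B → InBlock B x × InBlock B y) (λ B → InBlock? B x ×-dec InBlock? B y)

  ~-suc : ∀ a → a < n → a ~ suc a
  ~-suc a a<n with toℕ-next (fromℕ< (s≤s (<⇒≤ a<n)))
  ... | inj₁ e = inj₂ (fromℕ< (s≤s (<⇒≤ a<n))) , inj₁ (sym (toℕ-fromℕ< _))
               , inj₂ (trans (cong suc (sym (toℕ-fromℕ< _))) (sym e))
  ... | inj₂ (e , _) = ⊥-elim (<-irrefl (trans (sym (toℕ-fromℕ< _)) e) a<n)

  -- The largest y ∈ (a, m] with a ~ y (or a, if there is none).
  lastNeighbour : ℕ → ℕ → ℕ
  lastNeighbour a zero = a
  lastNeighbour a (suc m) with (a <? suc m) ×-dec (a ~? suc m)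
  ... | yes _ = suc m
  ... | no _  = lastNeighbour a m

  record LastNeighbour (a m y : ℕ) : Set where
    field
      a<y     : a < y
      y≤m     : y ≤ m
      a~y     : a ~ y
      is-last : ∀ z → y < z → z ≤ m → ¬ a ~ z

  -- Since a ~ a + 1, the search succeeds whenever a < m.
  lastNeighbour-spec : ∀ a m → a < m → a ~ suc a → LastNeighbour a m (lastNeighbour a m)
  lastNeighbour-spec a (suc m) a<sm a~sa with (a <? suc m) ×-dec (a ~? suc m)
  ... | yes (_ , a~sm) = record { a<y = a<sm ; y≤m = ≤-refl ; a~y = a~sm
                                ; is-last = λ z sm<z z≤sm → ⊥-elim (<-irrefl refl (≤-trans sm<z z≤sm)) }
  ... | no ¬found with m≤n⇒m<n∨m≡n (≤-pred a<sm)
  ...   | inj₂ refl = ⊥-elim (¬found (a<sm , a~sa))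
  ...   | inj₁ a<m = record { a<y = a<y ; y≤m = m≤n⇒m≤1+n y≤m ; a~y = a~y ; is-last = is-last′ }
    where
      open LastNeighbour (lastNeighbour-spec a m a<m a~sa)
      is-last′ : ∀ z → lastNeighbour a m < z → z ≤ suc m → ¬ a ~ z
      is-last′ z y<z z≤sm with m≤n⇒m<n∨m≡n z≤sm
      ... | inj₁ z<sm = is-last z y<z (≤-pred z<sm)
      ... | inj₂ refl = λ a~z → ¬found (a<sm , a~z)

  split : ℕ → ℕ → ℕ
  split a b = lastNeighbour a (pred b)

  record IsSplit (a b : ℕ) : Set where
    field
      a<c    : a < split a b
      c<b    : split a b < b
      a~c    : a ~ split a b
      c-last : ∀ y → split a b < y → y < b → ¬ a ~ y

  split-spec : ∀ a b → suc (suc a) ≤ b → b ≤ n → IsSplit a b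
  split-spec a (suc b) (s≤s a<b) sb≤n = record
    { a<c = a<y ; c<b = s≤s y≤m ; a~c = a~y ; c-last = λ z y<z z<sb → is-last z y<z (≤-pred z<sb) }
    where open LastNeighbour (lastNeighbour-spec a b a<b (~-suc a (≤-trans a<b (≤-trans (n≤1+n b) sb≤n))))

  CoBlock : ℕ → ℕ → ℕ → Set
  CoBlock a b x = ∃[ B ] (InBlock B a × InBlock B b × InBlock B x)

  InBag : ℕ → ℕ → ℕ → ℕ → Set
  InBag a b c x = x ≡ a ⊎ x ≡ b ⊎ x ≡ c ⊎ (a < x × x < b × CoBlock a b x)

  CoBlock? : ∀ a b x → Dec (CoBlock a b x)
  CoBlock? a b x = any-block? _ (λ B → InBlock? B a ×-dec InBlock? B b ×-dec InBlock? B x)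

  InBag? : ∀ a b c x → Dec (InBag a b c x)
  InBag? a b c x = (x ≟ a) ⊎-dec (x ≟ b) ⊎-dec (x ≟ c) ⊎-dec ((a <? x) ×-dec (x <? b) ×-dec CoBlock? a b x)

  InBag-range : ∀ {a b c x} → a < c → c < b → InBag a b c x → a ≤ x × x ≤ b
  InBag-range a<c c<b (inj₁ refl)                      = ≤-refl , <⇒≤ (<-trans a<c c<b)
  InBag-range a<c c<b (inj₂ (inj₁ refl))               = <⇒≤ (<-trans a<c c<b) , ≤-refl
  InBag-range a<c c<b (inj₂ (inj₂ (inj₁ refl)))        = <⇒≤ a<c , <⇒≤ c<b
  InBag-range a<c c<b (inj₂ (inj₂ (inj₂ (a<x , x<b , _)))) = <⇒≤ a<x , <⇒≤ x<b

  -- A block containing a, b and some x strictly between them also contains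
  -- the split point: otherwise it would cross the block joining a to it.
  split-in-block : ∀ {a b x} B → IsSplit a b → InBlock B a → InBlock B b → InBlock B x →
                   a < x → x < b → InBlock B (split a b)
  split-in-block {a} {b} {x} B sp ha hb hx a<x x<b with <-cmp x (split a b)
  ... | tri> _ _ c<x = ⊥-elim (IsSplit.c-last sp x c<x x<b (B , ha , hx))
  ... | tri≈ _ refl _ = hx
  ... | tri< x<c _ _ with IsSplit.a~c sp
  ...   | S , sa , sc with S ≟ᴮ B
  ...     | yes refl = sc
  ...     | no S≢B   = ⊥-elim (blocks-noncrossing S B S≢B a<x x<c (IsSplit.c<b sp) sa sc hx hb)

  -- A vertex strictly between a and the split point c of (a, b) that is
  -- in the bag of c shares a block with a and c, so it is in the bag of any
  -- split point c′ of (a, c).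
  bag-split-left : ∀ {a b x} c′ → IsSplit a b → a < x → x < split a b →
                   InBag a b (split a b) x → InBag a (split a b) c′ x
  bag-split-left c′ sp a<x x<c (inj₁ refl)              = ⊥-elim (<-irrefl refl a<x)
  bag-split-left c′ sp a<x x<c (inj₂ (inj₁ refl))       = ⊥-elim (<-asym x<c (IsSplit.c<b sp))
  bag-split-left c′ sp a<x x<c (inj₂ (inj₂ (inj₁ refl))) = ⊥-elim (<-irrefl refl x<c)
  bag-split-left c′ sp a<x x<c (inj₂ (inj₂ (inj₂ (_ , x<b , B , ha , hb , hx)))) =
    inj₂ (inj₂ (inj₂ (a<x , x<c , B , ha , split-in-block B sp ha hb hx a<x x<b , hx)))

  -- No vertex strictly between the split point c of (a, b) and b is in the
  -- bag of c: a block containing a, b and it would contradict the choice of c.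
  bag-split-right : ∀ {a b x} → IsSplit a b → split a b < x → x < b → ¬ InBag a b (split a b) x
  bag-split-right sp c<x x<b (inj₁ refl)               = <-asym (IsSplit.a<c sp) c<x
  bag-split-right sp c<x x<b (inj₂ (inj₁ refl))        = <-irrefl refl x<b
  bag-split-right sp c<x x<b (inj₂ (inj₂ (inj₁ refl))) = <-irrefl refl c<x
  bag-split-right sp c<x x<b (inj₂ (inj₂ (inj₂ (_ , _ , B , ha , _ , hx)))) =
    IsSplit.c-last sp _ c<x x<b (B , ha , hx)

  -- A pair x < y sharing a block and straddling the split point c of (a, b),
  -- other than (a, b) itself, lies in the bag of c: the block B of x and y
  -- cannot cross the block of a and c, so a ∈ B; by the choice of c this
  -- forces y = b, and then x ≠ a.
  straddle-in-bag : ∀ {a b x y} → IsSplit a b → a ≤ x → x < split a b → split a b < y → y ≤ b →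
                    x ~ y → ¬ (x ≡ a × y ≡ b) → InBag a b (split a b) x × InBag a b (split a b) y
  straddle-in-bag {a} {b} {x} {y} sp a≤x x<c c<y y≤b (B , bx , by) not-ends =
    inj₂ (inj₂ (inj₂ (a<x , <-trans x<c (IsSplit.c<b sp) , B , a∈B a<x , subst (InBlock B) y≡b by , bx))) ,
    inj₂ (inj₁ y≡b)
    where
      a∈B : a < x → InBlock B a
      a∈B a<x with IsSplit.a~c sp
      ... | S , sa , sc with S ≟ᴮ B
      ...   | yes refl = sa
      ...   | no S≢B   = ⊥-elim (blocks-noncrossing S B S≢B a<x x<c c<y sa sc bx by)
      a~y : a ~ y
      a~y with m≤n⇒m<n∨m≡n a≤x
      ... | inj₁ a<x = B , a∈B a<x , by
      ... | inj₂ a≡x = B , subst (InBlock B) (sym a≡x) bx , by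
      y≡b : y ≡ b
      y≡b with m≤n⇒m<n∨m≡n y≤b
      ... | inj₁ y<b = ⊥-elim (IsSplit.c-last sp y c<y y<b a~y)
      ... | inj₂ y≡b = y≡b
      a<x : a < x
      a<x = ≤∧≢⇒< a≤x (λ a≡x → not-ends (sym a≡x , y≡b))

  -- The bag of a split point lies in one clique, or consists of a, b and c
  -- only: a block joining a, b and another vertex of the bag is a clique
  -- (a cycle edge has two vertices) that also contains c.
  SmallBag : ℕ → ℕ → Set
  SmallBag a b = (∃[ j ] ∀ x → InBag a b (split a b) x → InBlock (inj₁ j) x)
               ⊎ (∀ x → InBag a b (split a b) x → x ≡ a ⊎ x ≡ b ⊎ x ≡ split a b)

  small-bag : ∀ a b → IsSplit a b → SmallBag a b
  small-bag a b sp with any? (λ j → InBlock? (inj₁ j) a ×-dec InBlock? (inj₁ j) b ×-dec InBlock? (inj₁ j) (split a b))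
  ... | yes (j , ha , hb , hc) = inj₁ (j , in-clique)
    where
      open IsSplit sp
      in-clique : ∀ x → InBag a b (split a b) x → InBlock (inj₁ j) x
      in-clique x (inj₁ refl)               = ha
      in-clique x (inj₂ (inj₁ refl))        = hb
      in-clique x (inj₂ (inj₂ (inj₁ refl))) = hc
      in-clique x (inj₂ (inj₂ (inj₂ (a<x , x<b , B , ha′ , hb′ , hx)))) with B ≟ᴮ inj₁ j
      ... | yes refl = hx
      ... | no B≢j with <-cmp x (split a b)
      ...   | tri≈ _ refl _ = hc
      ...   | tri< x<c _ _ = ⊥-elim (blocks-noncrossing (inj₁ j) B (≢-sym B≢j) a<x x<c c<b ha hc hx hb′)
      ...   | tri> _ _ c<x = ⊥-elim (blocks-noncrossing B (inj₁ j) B≢j a<c c<x x<b ha′ hx hc hb)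
  ... | no ¬clique = inj₂ three
    where
      three : ∀ x → InBag a b (split a b) x → x ≡ a ⊎ x ≡ b ⊎ x ≡ split a b
      three x (inj₁ e)               = inj₁ e
      three x (inj₂ (inj₁ e))        = inj₂ (inj₁ e)
      three x (inj₂ (inj₂ (inj₁ e))) = inj₂ (inj₂ e)
      three x (inj₂ (inj₂ (inj₂ (a<x , x<b , inj₁ j , ha , hb , hx)))) =
        ⊥-elim (¬clique (j , ha , hb , split-in-block (inj₁ j) sp ha hb hx a<x x<b))
      three x (inj₂ (inj₂ (inj₂ (a<x , x<b , inj₂ i , ha , hb , hx)))) =
        ⊥-elim (no-three-among-two ha hx hb a<x x<b)

  -- A frame records, for a node v, the
  -- interval (lo, hi) that v splits, the split point par of the enclosing
  -- interval (v's parent) and the depth of the recursion.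
  record Frame : Set where
    constructor frame
    field
      lo hi par depth : ℕ
  open Frame public

  -- frameOf f a b p d v: the frame of v when decomposing (a, b), which was
  -- split off by p at depth d; f is fuel, sufficient when b ≤ a + suc f.
  frameOf : (f a b p d v : ℕ) → Frame
  frameOf zero    a b p d v = frame a b p d
  frameOf (suc f) a b p d v with <-cmp v (split a b)
  ... | tri< _ _ _ = frameOf f a (split a b) (split a b) (suc d) v
  ... | tri≈ _ _ _ = frame a b p d
  ... | tri> _ _ _ = frameOf f (split a b) b (split a b) (suc d) v

  frameOf-left : ∀ f a b p d {v} → v < split a b →
                 frameOf (suc f) a b p d v ≡ frameOf f a (split a b) (split a b) (suc d) v
  frameOf-left f a b p d {v} v<c with <-cmp v (split a b)
  ... | tri< _ _ _  = refl
  ... | tri≈ ¬v<c _ _ = ⊥-elim (¬v<c v<c)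
  ... | tri> ¬v<c _ _ = ⊥-elim (¬v<c v<c)

  frameOf-right : ∀ f a b p d {v} → split a b < v →
                  frameOf (suc f) a b p d v ≡ frameOf f (split a b) b (split a b) (suc d) v
  frameOf-right f a b p d {v} c<v with <-cmp v (split a b)
  ... | tri< _ _ ¬c<v = ⊥-elim (¬c<v c<v)
  ... | tri≈ _ _ ¬c<v = ⊥-elim (¬c<v c<v)
  ... | tri> _ _ _    = refl

  gap≥2 : ∀ {a v b} → a < v → v < b → suc (suc a) ≤ b
  gap≥2 a<v v<b = ≤-trans (s≤s a<v) v<b

  fuel-needed : ∀ {a b} → suc (suc a) ≤ b → b ≤ a + 1 → ⊥
  fuel-needed {a} gap fuel = <-irrefl refl (≤-trans gap (≤-trans fuel (≤-reflexive (+-comm a 1))))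

  frameOf-split : ∀ f a b p d → b ≤ a + suc f → suc (suc a) ≤ b →
                  frameOf f a b p d (split a b) ≡ frame a b p d
  frameOf-split zero a b p d fuel gap = ⊥-elim (fuel-needed gap fuel)
  frameOf-split (suc f) a b p d _ _ with <-cmp (split a b) (split a b)
  ... | tri< _ c≢c _ = ⊥-elim (c≢c refl)
  ... | tri≈ _ _ _   = refl
  ... | tri> _ c≢c _ = ⊥-elim (c≢c refl)

  FrameBag : Frame → ℕ → ℕ → Set
  FrameBag J v x = InBag (lo J) (hi J) v x

  ParentBag : (ℕ → Frame) → Frame → ℕ → Set
  ParentBag I J x = FrameBag (I (par J)) (par J) x

  module Step (f a b p d : ℕ) (b≤n : b ≤ n) (fuel : b ≤ a + suc (suc f))
              (gap : suc (suc a) ≤ b) where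
    c : ℕ
    c = split a b
    sp : IsSplit a b
    sp = split-spec a b gap b≤n
    open IsSplit sp public

    c≤n : c ≤ n
    c≤n = <⇒≤ (<-≤-trans c<b b≤n)

    fuel-left : c ≤ a + suc f
    fuel-left = ≤-pred (≤-trans c<b (≤-trans fuel (≤-reflexive (+-suc a (suc f)))))

    fuel-right : b ≤ c + suc f
    fuel-right = ≤-trans fuel (≤-trans (≤-reflexive (+-suc a (suc f))) (+-monoˡ-≤ (suc f) a<c))

    I L R : ℕ → Frame
    I = frameOf (suc f) a b p d
    L = frameOf f a c c (suc d)
    R = frameOf f c b c (suc d)

    I-left : ∀ {v} → v < c → I v ≡ L v
    I-left = frameOf-left f a b p d

    I-right : ∀ {v} → c < v → I v ≡ R v
    I-right = frameOf-right f a b p d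

    I-split : I c ≡ frame a b p d
    I-split = frameOf-split (suc f) a b p d fuel gap

    bag-left : ∀ {v x} → v < c → FrameBag (L v) v x → FrameBag (I v) v x
    bag-left {v} {x} v<c = subst (λ J → FrameBag J v x) (sym (I-left v<c))

    bag-left⁻ : ∀ {v x} → v < c → FrameBag (I v) v x → FrameBag (L v) v x
    bag-left⁻ {v} {x} v<c = subst (λ J → FrameBag J v x) (I-left v<c)

    bag-right : ∀ {v x} → c < v → FrameBag (R v) v x → FrameBag (I v) v x
    bag-right {v} {x} c<v = subst (λ J → FrameBag J v x) (sym (I-right c<v))

    bag-right⁻ : ∀ {v x} → c < v → FrameBag (I v) v x → FrameBag (R v) v x
    bag-right⁻ {v} {x} c<v = subst (λ J → FrameBag J v x) (I-right c<v)

    bag-split : ∀ {x} → InBag a b c x → FrameBag (I c) c x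
    bag-split {x} = subst (λ J → FrameBag J c x) (sym I-split)

    parentBag-left : ∀ {v x} → v < c → par (L v) < c → ParentBag L (L v) x → ParentBag I (I v) x
    parentBag-left {v} {x} v<c par<c =
      subst (λ J → ParentBag I J x) (sym (I-left v<c)) ∘′ bag-left par<c

    parentBag-right : ∀ {v x} → c < v → c < par (R v) → ParentBag R (R v) x → ParentBag I (I v) x
    parentBag-right {v} {x} c<v c<par =
      subst (λ J → ParentBag I J x) (sym (I-right c<v)) ∘′ bag-right c<par

    -- the split points of (a, c) and of (c, b) are the children of c
    parentBag-left-split : ∀ {x} → suc (suc a) ≤ c → InBag a b c x → ParentBag I (I (split a c)) x
    parentBag-left-split {x} gap-l x∈ =
      subst (λ J → ParentBag I J x)
            (sym (trans (I-left (IsSplit.c<b (split-spec a c gap-l c≤n)))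
                        (frameOf-split f a c c (suc d) fuel-left gap-l)))
            (bag-split x∈)

    parentBag-right-split : ∀ {x} → suc (suc c) ≤ b → InBag a b c x → ParentBag I (I (split c b)) x
    parentBag-right-split {x} gap-r x∈ =
      subst (λ J → ParentBag I J x)
            (sym (trans (I-right (IsSplit.a<c (split-spec c b gap-r b≤n)))
                        (frameOf-split f c b c (suc d) fuel-right gap-r)))
            (bag-split x∈)

  record FrameWithin (a b : ℕ) (J : Frame) (v : ℕ) : Set where
    field
      a≤lo     : a ≤ lo J
      lo<v     : lo J < v
      v<hi     : v < hi J
      hi≤b     : hi J ≤ b
      v-splits : v ≡ split (lo J) (hi J)

  within-widen : ∀ {a a′ b b′ J v} → a ≤ a′ → b′ ≤ b → FrameWithin a′ b′ J v → FrameWithin a b J v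
  within-widen a≤a′ b′≤b w = record
    { a≤lo = ≤-trans a≤a′ a≤lo ; lo<v = lo<v ; v<hi = v<hi ; hi≤b = ≤-trans hi≤b b′≤b ; v-splits = v-splits }
    where open FrameWithin w

  frame-within : ∀ f a b p d → b ≤ n → b ≤ a + suc f → ∀ {v} → a < v → v < b →
                 FrameWithin a b (frameOf f a b p d v) v
  frame-within zero a b p d b≤n fuel a<v v<b = ⊥-elim (fuel-needed (gap≥2 a<v v<b) fuel)
  frame-within (suc f) a b p d b≤n fuel {v} a<v v<b = go (<-cmp v c)
    where
      open Step f a b p d b≤n fuel (gap≥2 a<v v<b)
      go : Tri (v < c) (v ≡ c) (c < v) → FrameWithin a b (I v) v
      go (tri< v<c _ _) = subst (λ J → FrameWithin a b J v) (sym (I-left v<c))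
        (within-widen ≤-refl (<⇒≤ c<b) (frame-within f a c c (suc d) c≤n fuel-left a<v v<c))
      go (tri≈ _ refl _) = subst (λ J → FrameWithin a b J v) (sym I-split) record
        { a≤lo = ≤-refl ; lo<v = a<v ; v<hi = v<b ; hi≤b = ≤-refl ; v-splits = refl }
      go (tri> _ _ c<v) = subst (λ J → FrameWithin a b J v) (sym (I-right c<v))
        (within-widen (<⇒≤ a<c) ≤-refl (frame-within f c b c (suc d) b≤n fuel-right c<v v<b))

  bag-within : ∀ f a b p d → b ≤ n → b ≤ a + suc f → ∀ {v x} → a < v → v < b →
               FrameBag (frameOf f a b p d v) v x → a ≤ x × x ≤ b
  bag-within f a b p d b≤n fuel {v} {x} a<v v<b x∈ =
    ≤-trans a≤lo (proj₁ range) , ≤-trans (proj₂ range) hi≤b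
    where
      open FrameWithin (frame-within f a b p d b≤n fuel a<v v<b)
      range : lo (frameOf f a b p d v) ≤ x × x ≤ hi (frameOf f a b p d v)
      range = InBag-range lo<v v<hi x∈

  record ParentInside (I : ℕ → Frame) (a b : ℕ) (J : Frame) : Set where
    field
      a<par  : a < par J
      par<b  : par J < b
      depth< : depth (I (par J)) < depth J

  parent-inside : ∀ f a b p d → b ≤ n → b ≤ a + suc f → ∀ {v} → a < v → v < b → v ≢ split a b →
                  ParentInside (frameOf f a b p d) a b (frameOf f a b p d v)
  parent-inside zero a b p d b≤n fuel a<v v<b _ = ⊥-elim (fuel-needed (gap≥2 a<v v<b) fuel)
  parent-inside (suc f) a b p d b≤n fuel {v} a<v v<b v≢c = go (<-cmp v c)
    where
      open Step f a b p d b≤n fuel (gap≥2 a<v v<b)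
      child-of-c : ∀ l h → ParentInside I a b (frame l h c (suc d))
      child-of-c l h = record
        { a<par = a<c ; par<b = c<b ; depth< = subst (λ J → depth J < suc d) (sym I-split) ≤-refl }
      go : Tri (v < c) (v ≡ c) (c < v) → ParentInside I a b (I v)
      go (tri≈ _ v≡c _) = ⊥-elim (v≢c v≡c)
      go (tri< v<c _ _) with v ≟ split a c
      ... | yes refl = subst (ParentInside I a b)
            (sym (trans (I-left v<c) (frameOf-split f a c c (suc d) fuel-left (gap≥2 a<v v<c)))) (child-of-c a c)
      ... | no v≢c′ = subst (ParentInside I a b) (sym (I-left v<c)) record
            { a<par = a<par ; par<b = <-trans par<b c<b
            ; depth< = subst (λ J → depth J < depth (L v)) (sym (I-left par<b)) depth< }
        where open ParentInside (parent-inside f a c c (suc d) c≤n fuel-left a<v v<c v≢c′)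
      go (tri> _ _ c<v) with v ≟ split c b
      ... | yes refl = subst (ParentInside I a b)
            (sym (trans (I-right c<v) (frameOf-split f c b c (suc d) fuel-right (gap≥2 c<v v<b)))) (child-of-c c b)
      ... | no v≢c′ = subst (ParentInside I a b) (sym (I-right c<v)) record
            { a<par = <-trans a<c a<par ; par<b = par<b
            ; depth< = subst (λ J → depth J < depth (R v)) (sym (I-right a<par)) depth< }
        where open ParentInside (parent-inside f c b c (suc d) b≤n fuel-right c<v v<b v≢c′)

  -- An end of (a, b) in the bag of a node other than the split point of
  -- (a, b) is also in the bag of that node's parent: going up, the frames
  -- keep the end until reaching the split point, whose bag contains it.
  end-in-parent-bag : ∀ f a b p d → b ≤ n → b ≤ a + suc f → ∀ {v x} → a < v → v < b →
                      v ≢ split a b → x ≡ a ⊎ x ≡ b → FrameBag (frameOf f a b p d v) v x →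
                      ParentBag (frameOf f a b p d) (frameOf f a b p d v) x
  end-in-parent-bag zero a b p d b≤n fuel a<v v<b _ _ _ = ⊥-elim (fuel-needed (gap≥2 a<v v<b) fuel)
  end-in-parent-bag (suc f) a b p d b≤n fuel {v} a<v v<b v≢c x-end x∈ = go (<-cmp v c) x-end x∈
    where
      open Step f a b p d b≤n fuel (gap≥2 a<v v<b)
      go : ∀ {x} → Tri (v < c) (v ≡ c) (c < v) → x ≡ a ⊎ x ≡ b → FrameBag (I v) v x → ParentBag I (I v) x
      go (tri≈ _ v≡c _) _ _ = ⊥-elim (v≢c v≡c)
      go (tri< v<c _ _) x-end x∈ with x-end | v ≟ split a c
      ... | inj₂ refl | _ = ⊥-elim (<⇒≱ c<b (proj₂
              (bag-within f a c c (suc d) c≤n fuel-left a<v v<c (bag-left⁻ v<c x∈))))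
      ... | inj₁ refl | yes refl = parentBag-left-split (gap≥2 a<v v<c) (inj₁ refl)
      ... | inj₁ refl | no v≢c′ = parentBag-left v<c
              (ParentInside.par<b (parent-inside f a c c (suc d) c≤n fuel-left a<v v<c v≢c′))
              (end-in-parent-bag f a c c (suc d) c≤n fuel-left a<v v<c v≢c′ (inj₁ refl) (bag-left⁻ v<c x∈))
      go (tri> _ _ c<v) x-end x∈ with x-end | v ≟ split c b
      ... | inj₁ refl | _ = ⊥-elim (<⇒≱ a<c (proj₁
              (bag-within f c b c (suc d) b≤n fuel-right c<v v<b (bag-right⁻ c<v x∈))))
      ... | inj₂ refl | yes refl = parentBag-right-split (gap≥2 c<v v<b) (inj₂ (inj₁ refl))
      ... | inj₂ refl | no v≢c′ = parentBag-right c<v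
              (ParentInside.a<par (parent-inside f c b c (suc d) b≤n fuel-right c<v v<b v≢c′))
              (end-in-parent-bag f c b c (suc d) b≤n fuel-right c<v v<b v≢c′ (inj₂ refl) (bag-right⁻ c<v x∈))

  record TopNode (I : ℕ → Frame) (a b x t : ℕ) : Set where
    field
      a<t  : a < t
      t<b  : t < b
      x∈t  : FrameBag (I t) t x
      top  : t ≡ split a b ⊎ ¬ ParentBag I (I t) x

  top-parent : ∀ {I a b x t} → TopNode I a b x t → t ≢ split a b → ¬ ParentBag I (I t) x
  top-parent tn t≢c with TopNode.top tn
  ... | inj₁ t≡c = ⊥-elim (t≢c t≡c)
  ... | inj₂ ¬pb = ¬pb

  -- A topmost node left of the split point c is topmost in (a, c), and x < c:
  -- x = c would be an end of (a, c) in its bag, hence in its parent's bag.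
  top-left : ∀ f a b p d → b ≤ n → b ≤ a + suc (suc f) → ∀ {x t} →
             TopNode (frameOf (suc f) a b p d) a b x t → t < split a b →
             x < split a b × TopNode (frameOf f a (split a b) (split a b) (suc d)) a (split a b) x t
  top-left f a b p d b≤n fuel {x} {t} tn t<c = x<c , record
    { a<t = a<t ; t<b = t<c ; x∈t = x∈L ; top = top-L (t ≟ split a c) }
    where
      open TopNode tn
      open Step f a b p d b≤n fuel (gap≥2 a<t t<b)
      x∈L : FrameBag (L t) t x
      x∈L = bag-left⁻ t<c x∈t
      ¬parent : ¬ ParentBag I (I t) x
      ¬parent = top-parent tn (<⇒≢ t<c)
      parent<c : t ≢ split a c → par (L t) < c
      parent<c t≢c′ = ParentInside.par<b (parent-inside f a c c (suc d) c≤n fuel-left a<t t<c t≢c′)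
      x≢c : x ≢ c
      x≢c refl with t ≟ split a c
      ... | yes refl = ¬parent (parentBag-left-split (gap≥2 a<t t<c) (inj₂ (inj₂ (inj₁ refl))))
      ... | no t≢c′ = ¬parent (parentBag-left t<c (parent<c t≢c′)
              (end-in-parent-bag f a c c (suc d) c≤n fuel-left a<t t<c t≢c′ (inj₂ refl) x∈L))
      x<c : x < c
      x<c = ≤∧≢⇒< (proj₂ (bag-within f a c c (suc d) c≤n fuel-left a<t t<c x∈L)) x≢c
      top-L : Dec (t ≡ split a c) → t ≡ split a c ⊎ ¬ ParentBag L (L t) x
      top-L (yes t≡c′) = inj₁ t≡c′
      top-L (no t≢c′)  = inj₂ (¬parent ∘′ parentBag-left t<c (parent<c t≢c′))

  top-right : ∀ f a b p d → b ≤ n → b ≤ a + suc (suc f) → ∀ {x t} →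
              TopNode (frameOf (suc f) a b p d) a b x t → split a b < t →
              split a b < x × TopNode (frameOf f (split a b) b (split a b) (suc d)) (split a b) b x t
  top-right f a b p d b≤n fuel {x} {t} tn c<t = c<x , record
    { a<t = c<t ; t<b = t<b ; x∈t = x∈R ; top = top-R (t ≟ split c b) }
    where
      open TopNode tn
      open Step f a b p d b≤n fuel (gap≥2 a<t t<b)
      x∈R : FrameBag (R t) t x
      x∈R = bag-right⁻ c<t x∈t
      ¬parent : ¬ ParentBag I (I t) x
      ¬parent = top-parent tn (>⇒≢ c<t)
      c<parent : t ≢ split c b → c < par (R t)
      c<parent t≢c′ = ParentInside.a<par (parent-inside f c b c (suc d) b≤n fuel-right c<t t<b t≢c′)
      x≢c : x ≢ c
      x≢c refl with t ≟ split c b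
      ... | yes refl = ¬parent (parentBag-right-split (gap≥2 c<t t<b) (inj₂ (inj₂ (inj₁ refl))))
      ... | no t≢c′ = ¬parent (parentBag-right c<t (c<parent t≢c′)
              (end-in-parent-bag f c b c (suc d) b≤n fuel-right c<t t<b t≢c′ (inj₁ refl) x∈R))
      c<x : c < x
      c<x = ≤∧≢⇒< (proj₁ (bag-within f c b c (suc d) b≤n fuel-right c<t t<b x∈R)) (≢-sym x≢c)
      top-R : Dec (t ≡ split c b) → t ≡ split c b ⊎ ¬ ParentBag R (R t) x
      top-R (yes t≡c′) = inj₁ t≡c′
      top-R (no t≢c′)  = inj₂ (¬parent ∘′ parentBag-right c<t (c<parent t≢c′))

  -- Topmost nodes on the
  -- same side of c are equal by induction and cannot lie on opposite sides
  -- of c.  If c is topmost, a topmost node right of c is impossible since x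
  -- would be a vertex of (c, b) in the bag of c; one left of c would by
  -- induction be the split point of (a, c), whose parent c has x in its bag.
  top-unique : ∀ f a b p d → b ≤ n → b ≤ a + suc f → ∀ {x t₁ t₂} → a < x → x < b →
               TopNode (frameOf f a b p d) a b x t₁ → TopNode (frameOf f a b p d) a b x t₂ → t₁ ≡ t₂
  top-unique zero a b p d b≤n fuel a<x x<b _ _ = ⊥-elim (fuel-needed (gap≥2 a<x x<b) fuel)
  top-unique (suc f) a b p d b≤n fuel {x} {t₁} {t₂} a<x x<b tn₁ tn₂ = compare (<-cmp t₁ c) (<-cmp t₂ c)
    where
      open Step f a b p d b≤n fuel (gap≥2 a<x x<b)
      at-c : ∀ {t} → t ≡ c → TopNode I a b x t → InBag a b c x
      at-c refl tn = subst (λ J → FrameBag J c x) I-split (TopNode.x∈t tn)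
      c-excludes : ∀ {t} → TopNode I a b x t → t ≢ c → ¬ InBag a b c x
      c-excludes {t} tn t≢c x∈c with <-cmp t c
      ... | tri≈ _ t≡c _ = t≢c t≡c
      ... | tri> _ _ c<t = bag-split-right sp (proj₁ (top-right f a b p d b≤n fuel tn c<t)) x<b x∈c
      ... | tri< t<c _ _ = top-parent tn t≢c
              (subst (λ s → ParentBag I (I s) x) (sym t≡c′) (parentBag-left-split (gap≥2 a<x x<c) x∈c))
        where
          x<c : x < c
          x<c = proj₁ (top-left f a b p d b≤n fuel tn t<c)
          sp-L : IsSplit a c
          sp-L = split-spec a c (gap≥2 a<x x<c) c≤n
          split-top : TopNode L a c x (split a c)
          split-top = record
            { a<t = IsSplit.a<c sp-L ; t<b = IsSplit.c<b sp-L ; top = inj₁ refl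
            ; x∈t = subst (λ J → FrameBag J (split a c) x)
                          (sym (frameOf-split f a c c (suc d) fuel-left (gap≥2 a<x x<c)))
                          (bag-split-left (split a c) sp a<x x<c x∈c) }
          t≡c′ : t ≡ split a c
          t≡c′ = top-unique f a c c (suc d) c≤n fuel-left a<x x<c (proj₂ (top-left f a b p d b≤n fuel tn t<c)) split-top
      compare : Tri (t₁ < c) (t₁ ≡ c) (c < t₁) → Tri (t₂ < c) (t₂ ≡ c) (c < t₂) → t₁ ≡ t₂
      compare (tri≈ _ e₁ _)   (tri≈ _ e₂ _)   = trans e₁ (sym e₂)
      compare (tri≈ _ e₁ _)   (tri< _ t₂≢c _) = ⊥-elim (c-excludes tn₂ t₂≢c (at-c e₁ tn₁))
      compare (tri≈ _ e₁ _)   (tri> _ t₂≢c _) = ⊥-elim (c-excludes tn₂ t₂≢c (at-c e₁ tn₁))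
      compare (tri< _ t₁≢c _) (tri≈ _ e₂ _)   = ⊥-elim (c-excludes tn₁ t₁≢c (at-c e₂ tn₂))
      compare (tri> _ t₁≢c _) (tri≈ _ e₂ _)   = ⊥-elim (c-excludes tn₁ t₁≢c (at-c e₂ tn₂))
      compare (tri< t₁<c _ _) (tri< t₂<c _ _) with top-left f a b p d b≤n fuel tn₁ t₁<c
      ... | x<c , tn₁-L = top-unique f a c c (suc d) c≤n fuel-left a<x x<c tn₁-L
                            (proj₂ (top-left f a b p d b≤n fuel tn₂ t₂<c))
      compare (tri> _ _ c<t₁) (tri> _ _ c<t₂) with top-right f a b p d b≤n fuel tn₁ c<t₁
      ... | c<x , tn₁-R = top-unique f c b c (suc d) b≤n fuel-right c<x x<b tn₁-R
                            (proj₂ (top-right f a b p d b≤n fuel tn₂ c<t₂))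
      compare (tri< t₁<c _ _) (tri> _ _ c<t₂) =
        ⊥-elim (<-asym (proj₁ (top-left f a b p d b≤n fuel tn₁ t₁<c)) (proj₁ (top-right f a b p d b≤n fuel tn₂ c<t₂)))
      compare (tri> _ _ c<t₁) (tri< t₂<c _ _) =
        ⊥-elim (<-asym (proj₁ (top-left f a b p d b≤n fuel tn₂ t₂<c)) (proj₁ (top-right f a b p d b≤n fuel tn₁ c<t₁)))

  record Covered (I : ℕ → Frame) (a b x y : ℕ) : Set where
    field
      node  : ℕ
      a<t   : a < node
      t<b   : node < b
      x∈t   : FrameBag (I node) node x
      y∈t   : FrameBag (I node) node y

  gap≥2-unless-ends : ∀ {a b x y} → x < y → a ≤ x → y ≤ b → ¬ (x ≡ a × y ≡ b) → suc (suc a) ≤ b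
  gap≥2-unless-ends {a} {b} {x} {y} x<y a≤x y≤b not-ends with suc (suc a) ≤? b
  ... | yes gap = gap
  ... | no ¬gap = ⊥-elim (not-ends (x≡a , y≡b))
    where
      b≤1+a : b ≤ suc a
      b≤1+a = ≤-pred (≰⇒> ¬gap)
      x≡a : x ≡ a
      x≡a = ≤-antisym (≤-pred (≤-trans x<y (≤-trans y≤b b≤1+a))) a≤x
      y≡b : y ≡ b
      y≡b = ≤-antisym y≤b (≤-trans b≤1+a (subst (λ z → suc z ≤ y) x≡a x<y))

  -- Every pair x < y in [a, b] sharing a block, other than (a, b) itself,
  -- lies in a common bag: recurse into the side of c containing both, or
  -- use the bag of c when (x, y) is an end pair of a side or straddles c.
  pair-covered : ∀ f a b p d → b ≤ n → b ≤ a + suc f → ∀ {x y} → x < y → a ≤ x → y ≤ b →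
                 x ~ y → ¬ (x ≡ a × y ≡ b) → Covered (frameOf f a b p d) a b x y
  pair-covered zero a b p d b≤n fuel x<y a≤x y≤b _ not-ends =
    ⊥-elim (fuel-needed (gap≥2-unless-ends x<y a≤x y≤b not-ends) fuel)
  pair-covered (suc f) a b p d b≤n fuel {x} {y} x<y a≤x y≤b x~y not-ends = go (y ≤? c) (c ≤? x)
    where
      open Step f a b p d b≤n fuel (gap≥2-unless-ends x<y a≤x y≤b not-ends)
      at-c : InBag a b c x → InBag a b c y → Covered I a b x y
      at-c x∈ y∈ = record { node = c ; a<t = a<c ; t<b = c<b ; x∈t = bag-split x∈ ; y∈t = bag-split y∈ }
      go : Dec (y ≤ c) → Dec (c ≤ x) → Covered I a b x y
      go (yes y≤c) _ with (x ≟ a) ×-dec (y ≟ c)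
      ... | yes (refl , refl) = at-c (inj₁ refl) (inj₂ (inj₂ (inj₁ refl)))
      ... | no not-ends′ = record
            { node = node ; a<t = a<t ; t<b = <-trans t<b c<b ; x∈t = bag-left t<b x∈t ; y∈t = bag-left t<b y∈t }
        where open Covered (pair-covered f a c c (suc d) c≤n fuel-left x<y a≤x y≤c x~y not-ends′)
      go (no _) (yes c≤x) with (x ≟ c) ×-dec (y ≟ b)
      ... | yes (refl , refl) = at-c (inj₂ (inj₂ (inj₁ refl))) (inj₂ (inj₁ refl))
      ... | no not-ends′ = record
            { node = node ; a<t = <-trans a<c a<t ; t<b = t<b ; x∈t = bag-right a<t x∈t ; y∈t = bag-right a<t y∈t }
        where open Covered (pair-covered f c b c (suc d) b≤n fuel-right x<y c≤x y≤b x~y not-ends′)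
      go (no y≰c) (no c≰x) = uncurry at-c (straddle-in-bag sp a≤x (≰⇒> c≰x) (≰⇒> y≰c) y≤b x~y not-ends)

  -- An interior vertex v gets its frame in the
  -- decomposition D of (0, n); node 0 is the root, with the frame (n, 0)
  -- whose bag is {0, n}, and node n is a child of 0 with bag {n}.
  D : ℕ → Frame
  D = frameOf n 0 n 0 1

  fuel-D : n ≤ 0 + suc n
  fuel-D = n≤1+n n

  D-split : suc (suc 0) ≤ n → D (split 0 n) ≡ frame 0 n 0 1
  D-split = frameOf-split n 0 n 0 1 fuel-D

  nodeFrame : ℕ → Frame
  nodeFrame v with v ≟ 0 | v ≟ n
  ... | yes _ | _     = frame n 0 0 0
  ... | no _  | yes _ = frame n n 0 1
  ... | no _  | no _  = D v

  nodeFrame-n : 0 < n → nodeFrame n ≡ frame n n 0 1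
  nodeFrame-n 0<n with n ≟ 0 | n ≟ n
  ... | yes n≡0 | _     = ⊥-elim (>⇒≢ 0<n n≡0)
  ... | no _    | yes _ = refl
  ... | no _    | no n≢n = ⊥-elim (n≢n refl)

  nodeFrame-inner : ∀ {v} → 0 < v → v < n → nodeFrame v ≡ D v
  nodeFrame-inner {v} 0<v v<n with v ≟ 0 | v ≟ n
  ... | yes v≡0 | _     = ⊥-elim (>⇒≢ 0<v v≡0)
  ... | no _    | yes v≡n = ⊥-elim (<⇒≢ v<n v≡n)
  ... | no _    | no _  = refl

  Bag : ℕ → ℕ → Set
  Bag v = FrameBag (nodeFrame v) v

  Bag? : ∀ v x → Dec (Bag v x)
  Bag? v = InBag? (lo (nodeFrame v)) (hi (nodeFrame v)) v

  parent rank : ℕ → ℕ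
  parent v = par (nodeFrame v)
  rank   v = depth (nodeFrame v)

  data NodeKind (t : ℕ) : Set where
    root  : t ≡ 0 → NodeKind t
    last  : 0 < n → t ≡ n → NodeKind t
    inner : 0 < t → t < n → NodeKind t

  kind : ∀ {t} → t ≤ n → NodeKind t
  kind {t} t≤n with t ≟ 0 | t ≟ n
  ... | yes t≡0 | _       = root t≡0
  ... | no t≢0  | yes t≡n = last (subst (0 <_) t≡n (n≢0⇒n>0 t≢0)) t≡n
  ... | no t≢0  | no t≢n  = inner (n≢0⇒n>0 t≢0) (≤∧≢⇒< t≤n t≢n)

  Bag-self : ∀ t → Bag t t
  Bag-self t = inj₂ (inj₂ (inj₁ refl))

  Bag-0⁺ : ∀ {x} → x ≡ 0 ⊎ x ≡ n → Bag 0 x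
  Bag-0⁺ (inj₁ x≡0) = inj₂ (inj₁ x≡0)
  Bag-0⁺ (inj₂ x≡n) = inj₁ x≡n

  Bag-0⁻ : ∀ {x} → Bag 0 x → x ≡ 0 ⊎ x ≡ n
  Bag-0⁻ (inj₁ x≡n)               = inj₂ x≡n
  Bag-0⁻ (inj₂ (inj₁ x≡0))        = inj₁ x≡0
  Bag-0⁻ (inj₂ (inj₂ (inj₁ x≡0))) = inj₁ x≡0
  Bag-0⁻ (inj₂ (inj₂ (inj₂ (n<x , x<0 , _)))) = ⊥-elim (n≮0 x<0)

  Bag-n⁻ : ∀ {x} → 0 < n → Bag n x → x ≡ n
  Bag-n⁻ {x} 0<n x∈ with subst (λ J → FrameBag J n x) (nodeFrame-n 0<n) x∈
  ... | inj₁ x≡n = x≡n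
  ... | inj₂ (inj₁ x≡n) = x≡n
  ... | inj₂ (inj₂ (inj₁ x≡n)) = x≡n
  ... | inj₂ (inj₂ (inj₂ (n<x , x<n , _))) = ⊥-elim (<-asym n<x x<n)

  Bag-inner⁺ : ∀ {t x} → 0 < t → t < n → FrameBag (D t) t x → Bag t x
  Bag-inner⁺ {t} {x} 0<t t<n = subst (λ J → FrameBag J t x) (sym (nodeFrame-inner 0<t t<n))

  Bag-inner⁻ : ∀ {t x} → 0 < t → t < n → Bag t x → FrameBag (D t) t x
  Bag-inner⁻ {t} {x} 0<t t<n = subst (λ J → FrameBag J t x) (nodeFrame-inner 0<t t<n)

  parent-split : ∀ {t} → 0 < t → t < n → t ≡ split 0 n → parent t ≡ 0
  parent-split 0<t t<n refl = cong par (trans (nodeFrame-inner 0<t t<n) (D-split (gap≥2 0<t t<n)))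

  parent-inner-bag : ∀ {t x} → 0 < t → t < n → t ≢ split 0 n → ParentBag D (D t) x → Bag (parent t) x
  parent-inner-bag {t} {x} 0<t t<n t≢c pb rewrite nodeFrame-inner 0<t t<n =
    Bag-inner⁺ a<par par<b pb
    where open ParentInside (parent-inside n 0 n 0 1 ≤-refl fuel-D 0<t t<n t≢c)

  parent-decreases : ∀ v → v ≤ n → v ≢ 0 → parent v ≤ n × rank (parent v) < rank v
  parent-decreases v v≤n v≢0 with kind v≤n
  ... | root v≡0 = ⊥-elim (v≢0 v≡0)
  ... | last 0<n refl rewrite nodeFrame-n 0<n = z≤n , s≤s z≤n
  ... | inner 0<v v<n with v ≟ split 0 n
  ...   | yes refl rewrite nodeFrame-inner 0<v v<n | D-split (gap≥2 0<v v<n) = z≤n , s≤s z≤n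
  ...   | no v≢c with parent-inside n 0 n 0 1 ≤-refl fuel-D 0<v v<n v≢c
  ...     | record { a<par = 0<p ; par<b = p<n ; depth< = depth< }
            rewrite nodeFrame-inner 0<v v<n | nodeFrame-inner 0<p p<n = <⇒≤ p<n , depth<

  TopmostFor : ℕ → ℕ → Set
  TopmostFor x t = t ≡ 0 ⊎ ¬ Bag (parent t) x

  -- For x ∈ {0, n} the only topmost node is the root: every other node
  -- whose bag contains x passes x on to its parent.
  end-topmost-is-root : ∀ {x t} → x ≡ 0 ⊎ x ≡ n → t ≤ n → Bag t x → TopmostFor x t → t ≡ 0
  end-topmost-is-root x-end t≤n x∈ (inj₁ t≡0) = t≡0
  end-topmost-is-root {x} {t} x-end t≤n x∈ (inj₂ ¬parent) with kind t≤n
  ... | root t≡0 = t≡0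
  ... | last 0<n refl = ⊥-elim (¬parent (subst (λ p → Bag p x) (sym (cong par (nodeFrame-n 0<n))) (Bag-0⁺ x-end)))
  ... | inner 0<t t<n with t ≟ split 0 n
  ...   | yes t≡c = ⊥-elim (¬parent (subst (λ p → Bag p x) (sym (parent-split 0<t t<n t≡c)) (Bag-0⁺ x-end)))
  ...   | no t≢c  = ⊥-elim (¬parent (parent-inner-bag 0<t t<n t≢c
              (end-in-parent-bag n 0 n 0 1 ≤-refl fuel-D 0<t t<n t≢c x-end (Bag-inner⁻ 0<t t<n x∈))))

  topmost-in-D : ∀ {x t} → 0 < x → x < n → t ≤ n → Bag t x → TopmostFor x t → TopNode D 0 n x t
  topmost-in-D {x} {t} 0<x x<n t≤n x∈ topmost with kind t≤n
  ... | root refl = ⊥-elim ([ >⇒≢ 0<x , <⇒≢ x<n ] (Bag-0⁻ x∈))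
  ... | last 0<n refl = ⊥-elim (<⇒≢ x<n (Bag-n⁻ 0<n x∈))
  ... | inner 0<t t<n = record { a<t = 0<t ; t<b = t<n ; x∈t = Bag-inner⁻ 0<t t<n x∈ ; top = top (t ≟ split 0 n) }
    where
      top : Dec (t ≡ split 0 n) → t ≡ split 0 n ⊎ ¬ ParentBag D (D t) x
      top (yes t≡c) = inj₁ t≡c
      top (no t≢c) = inj₂ (not-root topmost ∘′ parent-inner-bag 0<t t<n t≢c)
        where
          not-root : TopmostFor x t → ¬ Bag (parent t) x
          not-root (inj₁ t≡0)    = ⊥-elim (>⇒≢ 0<t t≡0)
          not-root (inj₂ ¬parent) = ¬parent

  topmost-unique : ∀ {x t₁ t₂} → x ≤ n → t₁ ≤ n → t₂ ≤ n → Bag t₁ x → Bag t₂ x →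
                   TopmostFor x t₁ → TopmostFor x t₂ → t₁ ≡ t₂
  topmost-unique {x} x≤n t₁≤n t₂≤n x∈₁ x∈₂ top₁ top₂ with kind x≤n
  ... | root x≡0 = trans (end-topmost-is-root (inj₁ x≡0) t₁≤n x∈₁ top₁)
                         (sym (end-topmost-is-root (inj₁ x≡0) t₂≤n x∈₂ top₂))
  ... | last _ x≡n = trans (end-topmost-is-root (inj₂ x≡n) t₁≤n x∈₁ top₁)
                           (sym (end-topmost-is-root (inj₂ x≡n) t₂≤n x∈₂ top₂))
  ... | inner 0<x x<n = top-unique n 0 n 0 1 ≤-refl fuel-D 0<x x<n
                          (topmost-in-D 0<x x<n t₁≤n x∈₁ top₁) (topmost-in-D 0<x x<n t₂≤n x∈₂ top₂)

  -- Two vertices sharing a block share a bag: 0 and n share the root's bag.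
  adjacent-covered : ∀ {x y} → x < y → y ≤ n → x ~ y → ∃[ t ] (t ≤ n × Bag t x × Bag t y)
  adjacent-covered {x} {y} x<y y≤n x~y with (x ≟ 0) ×-dec (y ≟ n)
  ... | yes (x≡0 , y≡n) = 0 , z≤n , Bag-0⁺ (inj₁ x≡0) , Bag-0⁺ (inj₂ y≡n)
  ... | no not-ends = node , <⇒≤ t<b , Bag-inner⁺ a<t t<b x∈t , Bag-inner⁺ a<t t<b y∈t
    where open Covered (pair-covered n 0 n 0 1 ≤-refl fuel-D x<y z≤n y≤n x~y not-ends)

  BagShape : ℕ → Set
  BagShape t = (∃[ j ] ∀ x → Bag t x → InBlock (inj₁ j) x)
             ⊎ (∃[ a ] ∃[ b ] ∃[ c ] (a ≤ n × b ≤ n × c ≤ n × ∀ x → Bag t x → x ≡ a ⊎ x ≡ b ⊎ x ≡ c))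

  bag-shape : ∀ t → t ≤ n → BagShape t
  bag-shape t t≤n with kind t≤n
  ... | root refl = inj₂ (0 , n , 0 , z≤n , ≤-refl , z≤n , λ x x∈ → [ inj₁ , inj₂ ∘′ inj₁ ] (Bag-0⁻ x∈))
  ... | last 0<n refl = inj₂ (n , n , n , ≤-refl , ≤-refl , ≤-refl , λ x x∈ → inj₁ (Bag-n⁻ 0<n x∈))
  ... | inner 0<t t<n = shape (small-bag (lo (D t)) (hi (D t)) (split-spec _ _ (gap≥2 lo<v v<hi) hi≤b))
    where
      open FrameWithin (frame-within n 0 n 0 1 ≤-refl fuel-D 0<t t<n)
      in-split-bag : ∀ {x} → Bag t x → InBag (lo (D t)) (hi (D t)) (split (lo (D t)) (hi (D t))) x
      in-split-bag {x} x∈ = subst (λ c → InBag (lo (D t)) (hi (D t)) c x) v-splits (Bag-inner⁻ 0<t t<n x∈)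
      shape : SmallBag (lo (D t)) (hi (D t)) → BagShape t
      shape (inj₁ (j , in-clique)) = inj₁ (j , λ x x∈ → in-clique x (in-split-bag x∈))
      shape (inj₂ three) = inj₂ (lo (D t) , hi (D t) , t , ≤-trans (<⇒≤ lo<v) t≤n , hi≤b , t≤n ,
        λ x x∈ → map₂ (map₂ (λ x≡c → trans x≡c (sym v-splits))) (three x (in-split-bag x∈)))

  module PT = ParentTree n parent rank parent-decreases

  bag : Fin (suc n) → Subset (suc n)
  bag t = subsetOf (λ i → Bag? (toℕ t) (toℕ i))

  ∈bag⁻ : ∀ {t i} → i ∈ bag t → Bag (toℕ t) (toℕ i)
  ∈bag⁻ {t} = ∈-subsetOf⁻ (λ j → Bag? (toℕ t) (toℕ j))

  ∈bag⁺ : ∀ {t i} → Bag (toℕ t) (toℕ i) → i ∈ bag t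
  ∈bag⁺ {t} = ∈-subsetOf⁺ (λ j → Bag? (toℕ t) (toℕ j))

  nodeAt : ∀ {t} → t ≤ n → Fin (suc n)
  nodeAt t≤n = fromℕ< (s≤s t≤n)

  ∈bag-nodeAt⁺ : ∀ {t i} (t≤n : t ≤ n) → Bag t (toℕ i) → i ∈ bag (nodeAt t≤n)
  ∈bag-nodeAt⁺ {i = i} t≤n = ∈bag⁺ ∘′ subst (λ s → Bag s (toℕ i)) (sym (toℕ-fromℕ< (s≤s t≤n)))

  pair-in-bag : ∀ (u w : Fin (suc n)) → toℕ u ~ toℕ w → ∃[ t ] (u ∈ bag t × w ∈ bag t)
  pair-in-bag u w u~w with <-cmp (toℕ u) (toℕ w)
  ... | tri≈ _ u≡w _ = u , ∈bag⁺ (Bag-self (toℕ u)) , subst (_∈ bag u) (toℕ-injective u≡w) (∈bag⁺ (Bag-self (toℕ u)))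
  ... | tri< u<w _ _ with adjacent-covered u<w (toℕ≤n w) u~w
  ...   | t , t≤n , u∈ , w∈ = nodeAt t≤n , ∈bag-nodeAt⁺ t≤n u∈ , ∈bag-nodeAt⁺ t≤n w∈
  pair-in-bag u w (B , hu , hw) | tri> _ _ w<u with adjacent-covered w<u (toℕ≤n u) (B , hw , hu)
  ...   | t , t≤n , w∈ , u∈ = nodeAt t≤n , ∈bag-nodeAt⁺ t≤n u∈ , ∈bag-nodeAt⁺ t≤n w∈

  -- Every edge of G is a cycle edge or lies in a clique, so its ends share a block.
  edge-in-bag : ∀ e → ∃[ t ] (proj₁ (ends G e) ∈ bag t × proj₂ (ends G e) ∈ bag t)
  edge-in-bag e = ends-in-bag (edge-block (any? (λ i → cyc i ≟ᶠ e)))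
    where
      edge-block : Dec (∃[ i ] cyc i ≡ e) → ∃[ u ] ∃[ w ] (Joins G e u w × toℕ u ~ toℕ w)
      edge-block (yes (i , refl)) = i , next i , cyc-joins i , inj₂ i , inj₁ refl , inj₂ refl
      edge-block (no ¬cycle) with Equivalence.to (cover e) ¬cycle
      ... | j , e∈Mj with es-ok (M j) e e∈Mj
      ...   | u , w , _ , u∈ , w∈ , joins = u , w , joins , inj₁ j , (u , refl , u∈) , (w , refl , w∈)
      ends-in-bag : ∃[ u ] ∃[ w ] (Joins G e u w × toℕ u ~ toℕ w) →
                    ∃[ t ] (proj₁ (ends G e) ∈ bag t × proj₂ (ends G e) ∈ bag t)
      ends-in-bag (u , w , joins , u~w) with pair-in-bag u w u~w | joins
      ... | t , u∈ , w∈ | inj₁ eq = t , subst (λ uw → proj₁ uw ∈ bag t × proj₂ uw ∈ bag t) (sym eq) (u∈ , w∈)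
      ... | t , u∈ , w∈ | inj₂ eq = t , subst (λ uw → proj₁ uw ∈ bag t × proj₂ uw ∈ bag t) (sym eq) (w∈ , u∈)

  -- The nodes whose bag contains v form a subtree, since their topmost node is unique.
  bags-connected : ∀ v (a b : Fin (suc n)) → v ∈ bag a → v ∈ bag b → WalkIn PT.Edge (λ s → v ∈ bag s) a b
  bags-connected v = PT.connect-within (λ s → v ∈ bag s) (λ s → v ∈? bag s) unique
    where
      topmost : ∀ t → PT.Topmost (λ s → v ∈ bag s) (λ s → v ∈? bag s) t → TopmostFor (toℕ v) (toℕ t)
      topmost t (inj₁ t≡0) = inj₁ t≡0
      topmost t (inj₂ ¬up) = root-or-not (toℕ t ≟ 0)
        where
          root-or-not : Dec (toℕ t ≡ 0) → TopmostFor (toℕ v) (toℕ t)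
          root-or-not (yes t≡0) = inj₁ t≡0
          root-or-not (no t≢0)  =
            inj₂ (λ v∈ → ¬up t≢0 (∈bag⁺ (subst (λ s → Bag s (toℕ v)) (sym (PT.toℕ-up t t≢0)) v∈)))
      unique : ∀ t₁ t₂ → v ∈ bag t₁ → v ∈ bag t₂ →
               PT.Topmost (λ s → v ∈ bag s) (λ s → v ∈? bag s) t₁ →
               PT.Topmost (λ s → v ∈ bag s) (λ s → v ∈? bag s) t₂ → t₁ ≡ t₂
      unique t₁ t₂ v∈₁ v∈₂ top₁ top₂ = toℕ-injective
        (topmost-unique (toℕ≤n v) (toℕ≤n t₁) (toℕ≤n t₂) (∈bag⁻ v∈₁) (∈bag⁻ v∈₂) (topmost t₁ top₁) (topmost t₂ top₂))

  decomposition : TreeDecomposition G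
  decomposition = record
    { T = PT.tree
    ; X = bag
    ; covers = λ v → v , ∈bag⁺ (Bag-self (toℕ v))
    ; edges = edge-in-bag
    ; subtree = bags-connected }

  -- A bag inside a clique has at most q vertices; otherwise at most three.
  width-bound : 1 ≤ q → HasWidth≤ decomposition ((q ∸ 1) ⊔ 2)
  width-bound 1≤q t with bag-shape (toℕ t) (toℕ≤n t)
  ... | inj₁ (j , in-clique) = ≤-trans (p⊆q⇒∣p∣≤∣q∣ bag⊆Mj) (≤-trans (small (M j)) q≤width)
    where
      bag⊆Mj : bag t ⊆ VS (M j)
      bag⊆Mj {i} i∈ with in-clique (toℕ i) (∈bag⁻ i∈)
      ... | i′ , i′≡i , i′∈ = subst (_∈ VS (M j)) (toℕ-injective i′≡i) i′∈
      q≤width : q ≤ (q ∸ 1) ⊔ 2 + 1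
      q≤width = ≤-trans (≤-reflexive (sym (m∸n+n≡m 1≤q))) (+-monoˡ-≤ 1 (m≤m⊔n (q ∸ 1) 2))
  ... | inj₂ (a , b , c , a≤n , b≤n , c≤n , among) =
    ≤-trans (∣⊆three∣≤3 (bag t) (nodeAt a≤n) (nodeAt b≤n) (nodeAt c≤n) (λ i i∈ → as-nodes (among (toℕ i) (∈bag⁻ i∈))))
            (+-monoˡ-≤ 1 (m≤n⊔m (q ∸ 1) 2))
    where
      is-node : ∀ {i x} (x≤n : x ≤ n) → toℕ i ≡ x → i ≡ nodeAt x≤n
      is-node x≤n e = toℕ-injective (trans e (sym (toℕ-fromℕ< (s≤s x≤n))))
      as-nodes : ∀ {i} → toℕ i ≡ a ⊎ toℕ i ≡ b ⊎ toℕ i ≡ c → i ≡ nodeAt a≤n ⊎ i ≡ nodeAt b≤n ⊎ i ≡ nodeAt c≤n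
      as-nodes (inj₁ e)        = inj₁ (is-node a≤n e)
      as-nodes (inj₂ (inj₁ e)) = inj₂ (inj₁ (is-node b≤n e))
      as-nodes (inj₂ (inj₂ e)) = inj₂ (inj₂ (is-node c≤n e))

lemma3p1 : ∀ (q : ℕ) → 1 ≤ q → ∀ {n} (G : Multigraph (suc n)) →
    IsNecklace q G → TreeWidth≤ G ((q ∸ 1) ⊔ 2)
lemma3p1 q 1≤q G N = Necklace.decomposition q G N , Necklace.width-bound q G N 1≤q
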